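{- Let $g\in\mathcal{E}$ with $g\neq\mathrm{id}_{\omega}$. Then there exists a continuous map $\sigma:\mathcal{E}\to\mathcal{E}$ such that for every $f\in\mathcal{E}$, \[\sigma(f\circ\mathsf{s})=\sigma(f)\circ g.\]
   Context: $\mathcal{E}$ is the set of strictly increasing (injective, increasing) maps $\omega\to\omega$, with the topology induced by the Baire space $\omega^{\omega}$. $\mathsf{s}\in\mathcal{E}$ is the successor function $\mathsf{s}(n)=n+1$. -}

module Defs where

open import Data.Nat using (ℕ; suc; _<_; s≤s)
open import Data.Product using (Σ; _,_; proj₁; proj₂; ∃-syntax)
open import Relation.Binary.PropositionalEquality using (_≡_)

StrictlyIncreasing : (ℕ → ℕ) → Set
StrictlyIncreasing f = ∀ {m n} → m < n → f m < f n

𝓔 : Set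
𝓔 = Σ (ℕ → ℕ) StrictlyIncreasing

⟦_⟧ : 𝓔 → ℕ → ℕ
⟦ f ⟧ = proj₁ f

𝗌 : 𝓔
𝗌 = suc , s≤s

_∘𝓔_ : 𝓔 → 𝓔 → 𝓔
(f , pf) ∘𝓔 (g , pg) = (λ n → f (g n)) , (λ m<n → pf (pg m<n))

_≈𝓔_ : 𝓔 → 𝓔 → Set
f ≈𝓔 g = ∀ n → ⟦ f ⟧ n ≡ ⟦ g ⟧ n

AgreeBelow : ℕ → (ℕ → ℕ) → (ℕ → ℕ) → Set
AgreeBelow k f g = ∀ i → i < k → f i ≡ g i

-- Continuity of σ : 𝓔 → 𝓔 for the topology induced by Baire space ω^ω
-- (basic open sets = sets of sequences with a given finite initial segment):
-- for every f and every k there is m such that any f' agreeing with f below m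
-- has σ f' agreeing with σ f below k.
Continuous : (𝓔 → 𝓔) → Set
Continuous σ = ∀ (f : 𝓔) (k : ℕ) → ∃[ m ] (∀ (f' : 𝓔) →
  AgreeBelow m ⟦ f ⟧ ⟦ f' ⟧ → AgreeBelow k ⟦ σ f ⟧ ⟦ σ f' ⟧)

-- Let j be the least point moved by g, so g fixes every i < j and j < g j. The orbit
-- j < g j < g² j < ⋯ cuts [j, ∞) into blocks [gˡ j, gˡ⁺¹ j), and g maps block l into
-- block l + 1. Let σ(f) fix every i < j and act on block l as g^(f(l) − l), which maps
-- it into block f(l). Then σ(f) is strictly increasing, its values below k depend only
-- on f below k, and on block l both σ(f ∘ s) and σ(f) ∘ g act as g^(f(l + 1) − l).
module Submission where

open import Defs
open import Data.Nat using (ℕ; zero; suc; _+_; _∸_; _≤_; _<_; _≤′_; ≤′-refl; ≤′-step; _<′_; z≤n; s≤s; _≤?_; _≟_)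
open import Data.Nat.Properties
open import Data.Nat.GeneralisedArithmetic using (fold; iterate)
open import Data.Product using (Σ; _×_; _,_; proj₂; ∃-syntax)
open import Data.Sum using (_⊎_; inj₁; inj₂)
open import Relation.Nullary using (¬_; yes; no; contradiction)
open import Relation.Unary using (Decidable)
open import Relation.Binary.PropositionalEquality
  using (_≡_; _≢_; refl; sym; trans; cong; subst; subst₂; ≢-sym; module ≡-Reasoning)

module _ {P : ℕ → Set} (P? : Decidable P) where

  private
    allBelow-or-firstFailure : ∀ n → (∀ i → i < n → P i) ⊎ ∃[ j ] ((∀ i → i < j → P i) × ¬ P j)
    allBelow-or-firstFailure zero = inj₁ (λ _ ())
    allBelow-or-firstFailure (suc n) with allBelow-or-firstFailure n | P? n
    ... | inj₂ failure | _      = inj₂ failure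
    ... | inj₁ below   | no ¬pn = inj₂ (n , below , ¬pn)
    ... | inj₁ below   | yes pn = inj₁ extended
      where
      extended : ∀ i → i < suc n → P i
      extended i i<1+n with m≤n⇒m<n∨m≡n (≤-pred i<1+n)
      ... | inj₁ i<n  = below i i<n
      ... | inj₂ refl = pn

  firstFailure : ∀ {n} → ¬ P n → ∃[ j ] ((∀ i → i < j → P i) × ¬ P j)
  firstFailure {n} ¬pn with allBelow-or-firstFailure (suc n)
  ... | inj₁ below   = contradiction (below n (n<1+n n)) ¬pn
  ... | inj₂ failure = failure

module _ {h : ℕ → ℕ} where

  strictlyIncreasing-suc : (∀ n → h n < h (suc n)) → StrictlyIncreasing h
  strictlyIncreasing-suc step {m} m<n = go (<⇒<′ m<n)
    where
    go : ∀ {n} → m <′ n → h m < h n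
    go ≤′-refl    = step m
    go (≤′-step p) = <-trans (go p) (step _)

  monotone-suc : (∀ n → h n ≤ h (suc n)) → ∀ {m n} → m ≤ n → h m ≤ h n
  monotone-suc step {m} m≤n = go (≤⇒≤′ m≤n)
    where
    go : ∀ {n} → m ≤′ n → h m ≤ h n
    go ≤′-refl    = ≤-refl
    go (≤′-step p) = ≤-trans (go p) (step _)

  module _ (h-inc : StrictlyIncreasing h) where

    strictlyIncreasing⇒monotone : ∀ {m n} → m ≤ n → h m ≤ h n
    strictlyIncreasing⇒monotone = monotone-suc (λ n → <⇒≤ (h-inc (n<1+n n)))

    strictlyIncreasing⇒inflationary : ∀ n → n ≤ h n
    strictlyIncreasing⇒inflationary zero    = z≤n
    strictlyIncreasing⇒inflationary (suc n) =
      ≤-<-trans (strictlyIncreasing⇒inflationary n) (h-inc (n<1+n n))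

    moved-upwardClosed : ∀ {n m} → n < h n → n ≤ m → m < h m
    moved-upwardClosed {n} n<hn n≤m = go (≤⇒≤′ n≤m)
      where
      go : ∀ {m} → n ≤′ m → m < h m
      go ≤′-refl    = n<hn
      go (≤′-step p) = ≤-<-trans (go p) (h-inc (n<1+n _))

module _ (h : ℕ → ℕ) where

  iterate-fixedPoint : ∀ {x} → h x ≡ x → ∀ N → iterate h x N ≡ x
  iterate-fixedPoint hx≡x zero    = refl
  iterate-fixedPoint hx≡x (suc N) =
    trans (cong (λ y → iterate h y N) hx≡x) (iterate-fixedPoint hx≡x N)

  module _ (h-inc : StrictlyIncreasing h) where

    iterate-inflationary : ∀ x N → x ≤ iterate h x N
    iterate-inflationary x zero    = ≤-refl
    iterate-inflationary x (suc N) =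
      ≤-trans (strictlyIncreasing⇒inflationary h-inc x) (iterate-inflationary (h x) N)

    iterate-strictlyIncreasing : ∀ N → StrictlyIncreasing (λ x → iterate h x N)
    iterate-strictlyIncreasing zero    x<y = x<y
    iterate-strictlyIncreasing (suc N) x<y = iterate-strictlyIncreasing N (h-inc x<y)

module Level (b : ℕ → ℕ) (b-inc : StrictlyIncreasing b) where

  -- level m is the l with b l ≤ m < b (suc l); it is 0 when m < b 0.
  level : ℕ → ℕ
  level zero = zero
  level (suc m) with b (suc (level m)) ≤? suc m
  ... | yes _ = suc (level m)
  ... | no  _ = level m

  <-next-level : ∀ m → m < b (suc (level m))
  <-next-level zero = ≤-<-trans z≤n (b-inc (n<1+n 0))
  <-next-level (suc m) with b (suc (level m)) ≤? suc m
  ... | yes _ = ≤-<-trans (<-next-level m) (b-inc (n<1+n _))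
  ... | no  q = ≰⇒> q

  private
    level-lower-or-zero : ∀ m → b (level m) ≤ m ⊎ level m ≡ 0
    level-lower-or-zero zero = inj₂ refl
    level-lower-or-zero (suc m) with b (suc (level m)) ≤? suc m | level-lower-or-zero m
    ... | yes q | _        = inj₁ q
    ... | no  _ | inj₁ low = inj₁ (m≤n⇒m≤1+n low)
    ... | no  _ | inj₂ l≡0 = inj₂ l≡0

  level-lower : ∀ {m} → b 0 ≤ m → b (level m) ≤ m
  level-lower {m} b0≤m with level-lower-or-zero m
  ... | inj₁ low = low
  ... | inj₂ l≡0 = subst (λ l → b l ≤ m) (sym l≡0) b0≤m

  level-≤ : ∀ m → level m ≤ m
  level-≤ zero = z≤n
  level-≤ (suc m) with b (suc (level m)) ≤? suc m
  ... | yes _ = s≤s (level-≤ m)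
  ... | no  _ = m≤n⇒m≤1+n (level-≤ m)

  level-mono : ∀ {m n} → m ≤ n → level m ≤ level n
  level-mono = monotone-suc step
    where
    step : ∀ m → level m ≤ level (suc m)
    step m with b (suc (level m)) ≤? suc m
    ... | yes _ = n≤1+n _
    ... | no  _ = ≤-refl

  level-reflects-< : ∀ {m n} → level m < level n → m < n
  level-reflects-< lm<ln = ≰⇒> (λ n≤m → <⇒≱ lm<ln (level-mono n≤m))

  level-unique : ∀ {l m} → b l ≤ m → m < b (suc l) → level m ≡ l
  level-unique {l} {m} bl≤m m<bl+1 = ≤-antisym (≮⇒≥ l<level) (≮⇒≥ level<l)
    where
    b-mono : ∀ {m n} → m ≤ n → b m ≤ b n
    b-mono = strictlyIncreasing⇒monotone b-inc

    level<l : ¬ level m < l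
    level<l lm<l = <⇒≱ (<-next-level m) (≤-trans (b-mono lm<l) bl≤m)

    l<level : ¬ l < level m
    l<level l<lm with level-lower-or-zero m
    ... | inj₁ low = <⇒≱ m<bl+1 (≤-trans (b-mono l<lm) low)
    ... | inj₂ l≡0 = n≮0 (subst (l <_) l≡0 l<lm)

module Construction (g : ℕ → ℕ) (g-inc : StrictlyIncreasing g) (j : ℕ)
                    (fixed-below : ∀ i → i < j → g i ≡ i) (j<gj : j < g j) where

  orbit : ℕ → ℕ
  orbit = fold j g

  j≤orbit : ∀ l → j ≤ orbit l
  j≤orbit zero    = ≤-refl
  j≤orbit (suc l) = ≤-trans (j≤orbit l) (strictlyIncreasing⇒inflationary g-inc _)

  orbit-inc : StrictlyIncreasing orbit
  orbit-inc = strictlyIncreasing-suc (λ l → moved-upwardClosed g-inc j<gj (j≤orbit l))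

  open Level orbit orbit-inc

  level-g : ∀ {x} → j ≤ x → level (g x) ≡ suc (level x)
  level-g {x} j≤x =
    level-unique (strictlyIncreasing⇒monotone g-inc (level-lower j≤x)) (g-inc (<-next-level x))

  level-iterate : ∀ {x} → j ≤ x → ∀ N → level (iterate g x N) ≡ N + level x
  level-iterate     j≤x zero    = refl
  level-iterate {x} j≤x (suc N) = begin
    level (iterate g (g x) N) ≡⟨ level-iterate j≤gx N ⟩
    N + level (g x)           ≡⟨ cong (N +_) (level-g j≤x) ⟩
    N + suc (level x)         ≡⟨ +-suc N (level x) ⟩
    suc (N + level x)         ∎
    where
    open ≡-Reasoning
    j≤gx : j ≤ g x
    j≤gx = ≤-trans j≤x (strictlyIncreasing⇒inflationary g-inc x)

  exponent : (ℕ → ℕ) → ℕ → ℕ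
  exponent f m = f (level m) ∸ level m

  σ : (ℕ → ℕ) → ℕ → ℕ
  σ f m = iterate g m (exponent f m)

  σ-fixed-below : ∀ f {m} → m < j → σ f m ≡ m
  σ-fixed-below f {m} m<j = iterate-fixedPoint g (fixed-below m m<j) (exponent f m)

  level-σ : ∀ {f} → StrictlyIncreasing f → ∀ {m} → j ≤ m → level (σ f m) ≡ f (level m)
  level-σ {f} f-inc {m} j≤m =
    trans (level-iterate j≤m _) (m∸n+n≡m (strictlyIncreasing⇒inflationary f-inc (level m)))

  σ-step : ∀ {f} → StrictlyIncreasing f → ∀ m → σ f m < σ f (suc m)
  σ-step {f} f-inc m with j ≤? m
  ... | no  m≱j = subst (_< σ f (suc m)) (sym (σ-fixed-below f (≰⇒> m≱j)))
                        (iterate-inflationary g g-inc (suc m) (exponent f (suc m)))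
  ... | yes j≤m with m≤n⇒m<n∨m≡n (level-mono (n≤1+n m))
  ...   | inj₂ same = subst (λ l → iterate g m (f l ∸ l) < σ f (suc m)) (sym same)
                            (iterate-strictlyIncreasing g g-inc (exponent f (suc m)) (n<1+n m))
  ...   | inj₁ up   = level-reflects-<
                        (subst₂ _<_ (sym (level-σ f-inc j≤m)) (sym (level-σ f-inc (m≤n⇒m≤1+n j≤m)))
                                (f-inc up))

  σ-𝓔 : 𝓔 → 𝓔
  σ-𝓔 f = σ ⟦ f ⟧ , strictlyIncreasing-suc (σ-step (proj₂ f))

  σ-continuous : Continuous σ-𝓔
  σ-continuous f k = k , λ f' agree i i<k →
    cong (λ y → iterate g i (y ∸ level i)) (agree (level i) (≤-<-trans (level-≤ i) i<k))

  σ-intertwines : ∀ f → σ-𝓔 (f ∘𝓔 𝗌) ≈𝓔 (σ-𝓔 f ∘𝓔 (g , g-inc))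
  σ-intertwines (f , f-inc) m with j ≤? m
  ... | no m≱j = begin
    σ (λ n → f (suc n)) m ≡⟨ σ-fixed-below (λ n → f (suc n)) (≰⇒> m≱j) ⟩
    m                     ≡⟨ σ-fixed-below f (≰⇒> m≱j) ⟨
    σ f m                 ≡⟨ cong (σ f) (fixed-below m (≰⇒> m≱j)) ⟨
    σ f (g m)             ∎
    where open ≡-Reasoning
  ... | yes j≤m = begin
    iterate g m (f (suc l) ∸ l)
      ≡⟨ cong (iterate g m) (+-∸-assoc 1 (strictlyIncreasing⇒inflationary f-inc (suc l))) ⟩
    iterate g (g m) (f (suc l) ∸ suc l)
      ≡⟨ cong (λ l′ → iterate g (g m) (f l′ ∸ l′)) (level-g j≤m) ⟨
    σ f (g m)
      ∎
    where
    open ≡-Reasoning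
    l : ℕ
    l = level m

lemma4p15 : (g : 𝓔) → ∃[ n ] (⟦ g ⟧ n ≢ n) →
    Σ (𝓔 → 𝓔) (λ σ → Continuous σ × (∀ (f : 𝓔) → σ (f ∘𝓔 𝗌) ≈𝓔 (σ f ∘𝓔 g)))
lemma4p15 (g , g-inc) (n , gn≢n) with firstFailure (λ i → g i ≟ i) gn≢n
... | j , fixed-below , gj≢j = σ-𝓔 , σ-continuous , σ-intertwines
  where
  open Construction g g-inc j fixed-below
    (≤∧≢⇒< (strictlyIncreasing⇒inflationary g-inc j) (≢-sym gj≢j))
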